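{- Let $D$ be a digraph, $v$ a vertex and $\omega$ an end of $D$. Then $v\omega$ is a limit edge of $D$ if and only if there is a necklace $N\subseteq D$ representing $\omega$ such that $D$ has an edge from $v$ to every bead of $N$. Likewise, $\omega v$ is a limit edge of $D$ if and only if there is a necklace $N\subseteq D$ representing $\omega$ such that $D$ has an edge from every bead of $N$ to $v$.
   Context: Digraphs have no loops and no parallel edges, but may contain both $uv$ and $vu$. $\mathcal{X}(D)$ is the set of finite subsets of $V(D)$. A ray is a digraph on distinct vertices $v_0,v_1,\dots$ with edges $v_iv_{i+1}$; its tails are its subrays. A ray $R\subseteq D$ is solid if for every $X\in\mathcal{X}(D)$ some tail of $R$ lies in a single strong component of $D-X$. Two solid rays are equivalent if for every $X$ they have tails in the same strong component of $D-X$; equivalence classes are the ends. $C(X,\omega)$ is the strong component of $D-X$ containing a tail of every ray in $\omega$. For a vertex $v$ and an end $\omega$: $v\omega$ is a limit edge if $D$ has an edge from $v$ to $C(X,\omega)$ for every $X\in\mathcal{X}(D)$ with $v\notin C(X,\omega)$; $\omega v$ is a limit edge if $D$ has an edge from $C(X,\omega)$ to $v$ for every $X\in\mathcal{X}(D)$ with $v\notin C(X,\omega)$. An $A$–$B$ path is a directed path meeting $A$ exactly in its first and $B$ exactly in its last vertex. A necklace is a union of pairwise disjoint finite vertex sets $Y_0,Y_1,\dots$ (beads), each spanning a strongly connected digraph on $Y_i$, together with, for each $i$, a $Y_i$–$Y_{i+1}$ path and a $Y_{i+1}$–$Y_i$ path, all these paths internally disjoint from each other and from all beads. A necklace $N\subseteq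 D$ represents an end $\omega$ if some (equivalently every) ray contained in $N$ belongs to $\omega$. -}

module Defs where

open import Level using (0ℓ)
open import Data.Nat using (ℕ; suc; _≤_)
open import Data.Bool using (Bool; true; false)
open import Data.List using (List; []; _∷_; _++_; [_])
open import Data.List.Membership.Propositional using (_∈_; _∉_)
open import Data.List.Relation.Unary.Unique.Propositional using (Unique)
open import Data.List.Relation.Unary.Linked using (Linked)
open import Data.Product using (Σ; ∃; _×_; _,_)
open import Data.Sum using (_⊎_)
open import Data.Empty using (⊥)
open import Relation.Nullary using (¬_)
open import Relation.Binary.PropositionalEquality using (_≡_; _≢_)
open import Function.Bundles using (_⇔_)

-- Digraphs: a (possibly infinite) vertex type and an edge relation,
-- without loops.  An edge relation (rather than an edge set) means
-- there are no parallel edges; both uv and vu may be present.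

record Digraph : Set₁ where
  field
    V       : Set
    E       : V → V → Set
    no-loop : ∀ v → ¬ E v v

open Digraph public

module _ (D : Digraph) where

  -- Finite vertex sets X ∈ 𝒳(D) are represented by lists of vertices.

  -- Directed walks inside the vertex set S ⊆ V(D) (every vertex in S).
  -- Reachability in D[S]; in particular D - X is S = (λ u → u ∉ X).
  data Reach (S : V D → Set) : V D → V D → Set where
    here : ∀ {x} → S x → Reach S x x
    step : ∀ {x y z} → S x → E D x y → Reach S y z → Reach S x z

  SameComp : List (V D) → V D → V D → Set
  SameComp X x y = Reach (λ u → u ∉ X) x y × Reach (λ u → u ∉ X) y x

  record Ray : Set where
    field
      vtx  : ℕ → V D
      inj  : ∀ i j → vtx i ≡ vtx j → i ≡ j
      edge : ∀ i → E D (vtx i) (vtx (suc i))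
  open Ray public

  TailIn : List (V D) → Ray → ℕ → Set
  TailIn X R n = ∀ m → n ≤ m → SameComp X (vtx R n) (vtx R m)

  Solid : Ray → Set
  Solid R = ∀ (X : List (V D)) → ∃ λ n → TailIn X R n

  Equiv : Ray → Ray → Set
  Equiv R S = ∀ (X : List (V D)) →
    Σ ℕ λ n → Σ ℕ λ m → TailIn X R n × TailIn X S m × SameComp X (vtx R n) (vtx S m)

  -- The end ω is represented by a solid ray R (ω = class of R).
  -- w ∈ C(X, ω): w is in the strong component of D - X containing a tail of R.
  InC : List (V D) → Ray → V D → Set
  InC X R w = ∃ λ n → TailIn X R n × SameComp X (vtx R n) w

  LimitOut : V D → Ray → Set
  LimitOut v R = ∀ (X : List (V D)) → ¬ InC X R v →
    ∃ λ w → InC X R w × E D v w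

  LimitIn : V D → Ray → Set
  LimitIn v R = ∀ (X : List (V D)) → ¬ InC X R v →
    ∃ λ w → InC X R w × E D w v

  Consec : List (V D) → V D → V D → Set
  Consec []            x y = ⊥
  Consec (a ∷ [])      x y = ⊥
  Consec (a ∷ b ∷ l)   x y = (x ≡ a × y ≡ b) ⊎ Consec (b ∷ l) x y

  -- Path indices: (i , true) is the Y_i–Y_{i+1} path,
  -- (i , false) is the Y_{i+1}–Y_i path.
  PIdx : Set
  PIdx = ℕ × Bool

  from : PIdx → ℕ
  from (i , true)  = i
  from (i , false) = suc i

  to : PIdx → ℕ
  to (i , true)  = suc i
  to (i , false) = i

  record Necklace : Set where
    field
      bead        : ℕ → List (V D)
      bead-strong : ∀ i x y → x ∈ bead i → y ∈ bead i →
                    Reach (λ u → u ∈ bead i) x y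
      bead-disj   : ∀ i j → i ≢ j → ∀ x → x ∈ bead i → x ∈ bead j → ⊥
      start       : PIdx → V D
      inner       : PIdx → List (V D)
      stop        : PIdx → V D
      path-edges  : ∀ p → Linked (E D) (start p ∷ inner p ++ [ stop p ])
      path-unique : ∀ p → Unique (start p ∷ inner p ++ [ stop p ])
      start-in    : ∀ p → start p ∈ bead (from p)
      start-out   : ∀ p → start p ∉ bead (to p)
      stop-in     : ∀ p → stop p ∈ bead (to p)
      stop-out    : ∀ p → stop p ∉ bead (from p)
      inner-bead  : ∀ p i x → x ∈ inner p → x ∈ bead i → ⊥
      inner-disj  : ∀ p q → p ≢ q → ∀ x → x ∈ inner p → x ∈ inner q → ⊥
  open Necklace public

  -- Edges of the subdigraph N ⊆ D (beads taken with the edges of D they span).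
  EdgeN : Necklace → V D → V D → Set
  EdgeN N x y =
    (∃ λ i → x ∈ bead N i × y ∈ bead N i × E D x y)
    ⊎ (∃ λ p → Consec (start N p ∷ inner N p ++ [ stop N p ]) x y)

  RayIn : Necklace → Ray → Set
  RayIn N S = ∀ i → EdgeN N (vtx S i) (vtx S (suc i))

  Represents : Necklace → Ray → Set
  Represents N R = ∃ λ S → RayIn N S × Equiv S R

module Submission where

-- If a necklace represents ω, then for finite X its beads and paths far out avoid X and lie in one
-- strong component of D − X, namely C(X, ω); a far bead supplies the required edge.
-- Conversely the necklace is built bead by bead: after deleting a finite U ∋ v with the current bead
-- inside C(U, ω), the limit condition applied to U and the bead gives a neighbour of v further out,
-- through which the next bead and the two paths to it are routed; every bead meets the ray arbitrarily
-- late, so the necklace represents ω. Excluded middle decides membership and bounds indices.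

open import Defs
open import Level using (0ℓ)
open import Axiom.ExcludedMiddle using (ExcludedMiddle)
open import Data.Nat using (ℕ; zero; suc; _≤_; _<_; _⊔_; _+_; _∸_; z≤n; s≤s; _≤′_; ≤′-refl; ≤′-step)
open import Data.Nat.Properties
  using (_≟_; _<?_; _≤?_; <-cmp; <-irrefl; ≤-refl; ≤-trans; ≤-antisym; <-≤-trans; <⇒≱; ≮⇒≥; ≰⇒>;
         n≤1+n; n<1+n; 1+n≢n; m≤m⊔n; m≤n⊔m; m≤m+n; m≤n+m; m∸n+n≡m; +-suc; +-identityʳ; ≤⇒≤′)
open import Relation.Binary using (tri<; tri≈; tri>)
open import Data.Bool using (true; false)
open import Data.List using (List; []; _∷_; _++_; [_]; length)
open import Data.List.Properties using (++-assoc)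
open import Data.List.Membership.Propositional using (_∈_; _∉_)
open import Data.List.Membership.Propositional.Properties using (∈-++⁺ˡ; ∈-++⁺ʳ; ∈-++⁻; ∈-length)
open import Data.List.Relation.Binary.Subset.Propositional using (_⊆_)
open import Data.List.Relation.Unary.Any using (here; there)
open import Data.List.Relation.Unary.All as All using (All)
open import Data.List.Relation.Unary.All.Properties using (¬Any⇒All¬)
open import Data.List.Relation.Unary.AllPairs using ([]; _∷_)
open import Data.List.Relation.Unary.Unique.Propositional using (Unique)
open import Data.List.Relation.Unary.Linked using (Linked; [-]; _∷_)
open import Data.Product using (∃; _×_; _,_; proj₁; proj₂)
open import Data.Sum using (_⊎_; inj₁; inj₂)
open import Data.Empty using (⊥; ⊥-elim)
open import Relation.Nullary using (¬_; Dec; yes; no)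
open import Function.Bundles using (_⇔_; mk⇔)
open import Relation.Binary.PropositionalEquality using (_≡_; _≢_; refl; sym; trans; cong; subst; module ≡-Reasoning)

module _ {A : Set} where

  head∉tail : ∀ {x : A} {xs} → Unique (x ∷ xs) → x ∉ xs
  head∉tail (x≢ ∷ _) x∈ = All.lookup x≢ x∈ refl

  unique-++⁻ˡ : ∀ (l : List A) {r} → Unique (l ++ r) → Unique l
  unique-++⁻ˡ []      _        = []
  unique-++⁻ˡ (a ∷ l) (a≢ ∷ un) = All.tabulate (λ x∈ → All.lookup a≢ (∈-++⁺ˡ x∈)) ∷ unique-++⁻ˡ l un

  unique-++-∷ : ∀ (l : List A) {x r} → Unique (l ++ [ x ]) → Unique (x ∷ r) → (∀ {u} → u ∈ l → u ∉ r) →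
    Unique (l ++ x ∷ r)
  unique-++-∷ []      _          un-r _ = un-r
  unique-++-∷ (a ∷ l) {x} {r} (a≢ ∷ un-l) un-r disj =
    All.tabulate a≢-rest ∷ unique-++-∷ l un-l un-r (λ u∈ → disj (there u∈))
    where
      a≢-rest : ∀ {u} → u ∈ l ++ x ∷ r → a ≢ u
      a≢-rest u∈ with ∈-++⁻ l u∈
      ... | inj₁ u∈l         = All.lookup a≢ (∈-++⁺ˡ u∈l)
      ... | inj₂ (here refl) = All.lookup a≢ (∈-++⁺ʳ l (here refl))
      ... | inj₂ (there u∈r) = λ { refl → disj (here refl) u∈r }

  ∈-++-elim : ∀ {P : A → Set} l {l′} → (∀ {u} → u ∈ l → P u) → (∀ {u} → u ∈ l′ → P u) →
    ∀ {u} → u ∈ l ++ l′ → P u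
  ∈-++-elim l f g u∈ with ∈-++⁻ l u∈
  ... | inj₁ u∈l  = f u∈l
  ... | inj₂ u∈l′ = g u∈l′

  ∈-∷ʳ-++⁺ˡ : ∀ {u b : A} l l′ → u ∈ l ++ [ b ] → u ∈ (l ++ l′) ++ [ b ]
  ∈-∷ʳ-++⁺ˡ l l′ u∈ with ∈-++⁻ l u∈
  ... | inj₁ u∈l         = ∈-++⁺ˡ (∈-++⁺ˡ u∈l)
  ... | inj₂ (here refl) = ∈-++⁺ʳ (l ++ l′) (here refl)

  ∈-∷ʳ-++⁺ʳ : ∀ {u b : A} l l′ → u ∈ l′ ++ [ b ] → u ∈ (l ++ l′) ++ [ b ]
  ∈-∷ʳ-++⁺ʳ {u} {b} l l′ u∈ = subst (u ∈_) (sym (++-assoc l l′ [ b ])) (∈-++⁺ʳ l u∈)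

  maxOver : (A → ℕ) → List A → ℕ
  maxOver f []      = 0
  maxOver f (x ∷ X) = f x ⊔ maxOver f X

  ≤-maxOver : ∀ f {x X} → x ∈ X → f x ≤ maxOver f X
  ≤-maxOver f {X = y ∷ X} (here refl) = m≤m⊔n (f y) (maxOver f X)
  ≤-maxOver f {X = y ∷ X} (there x∈)  = ≤-trans (≤-maxOver f x∈) (m≤n⊔m (f y) (maxOver f X))

  lookupOr : A → List A → ℕ → A
  lookupOr d []      j       = d
  lookupOr d (a ∷ l) zero    = a
  lookupOr d (a ∷ l) (suc j) = lookupOr d l j

  lookupOr-∈ : ∀ d l j → j < length l → lookupOr d l j ∈ l
  lookupOr-∈ d (a ∷ l) zero    _       = here refl
  lookupOr-∈ d (a ∷ l) (suc j) (s≤s p) = there (lookupOr-∈ d l j p)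

  lookupOr-++ˡ : ∀ d d′ l r j → j < length l → lookupOr d (l ++ r) j ≡ lookupOr d′ l j
  lookupOr-++ˡ d d′ (a ∷ l) r zero    _       = refl
  lookupOr-++ˡ d d′ (a ∷ l) r (suc j) (s≤s p) = lookupOr-++ˡ d d′ l r j p

  lookupOr-length : ∀ d l (z : A) → lookupOr d (l ++ [ z ]) (length l) ≡ z
  lookupOr-length d []      z = refl
  lookupOr-length d (a ∷ l) z = lookupOr-length d l z

  lookupOr-injective : ∀ d l j j′ → Unique l → j < length l → j′ < length l →
    lookupOr d l j ≡ lookupOr d l j′ → j ≡ j′
  lookupOr-injective d (a ∷ l) zero    zero     _        _       _       _  = refl
  lookupOr-injective d (a ∷ l) zero    (suc j′) un       _       (s≤s q) eq =
    ⊥-elim (head∉tail un (subst (_∈ l) (sym eq) (lookupOr-∈ d l j′ q)))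
  lookupOr-injective d (a ∷ l) (suc j) zero     un       (s≤s p) _       eq =
    ⊥-elim (head∉tail un (subst (_∈ l) eq (lookupOr-∈ d l j p)))
  lookupOr-injective d (a ∷ l) (suc j) (suc j′) (_ ∷ un) (s≤s p) (s≤s q) eq =
    cong suc (lookupOr-injective d l j j′ un p q eq)

module _ (D : Digraph) where

  Outside : List (V D) → V D → Set
  Outside X u = u ∉ X

  reach-map : ∀ {S S′ : V D → Set} → (∀ {u} → S u → S′ u) → ∀ {x y} → Reach D S x y → Reach D S′ x y
  reach-map f (here s)     = here (f s)
  reach-map f (step s e ρ) = step (f s) e (reach-map f ρ)

  reach-trans : ∀ {S x y z} → Reach D S x y → Reach D S y z → Reach D S x z
  reach-trans (here _)     σ = σ
  reach-trans (step s e ρ) σ = step s e (reach-trans ρ σ)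

  reach-head : ∀ {S x y} → Reach D S x y → S x
  reach-head (here s)     = s
  reach-head (step s _ _) = s

  reach-last : ∀ {S x y} → Reach D S x y → S y
  reach-last (here s)     = s
  reach-last (step _ _ ρ) = reach-last ρ

  reach-inside-component : ∀ {S a x y} → Reach D S a x → Reach D S x y → Reach D S y a →
    Reach D (λ u → S u × Reach D S a u × Reach D S u a) x y
  reach-inside-component ax (here s)     ya = here (s , ax , ya)
  reach-inside-component ax (step s e ρ) ya =
    step (s , ax , step s e (reach-trans ρ ya)) e
         (reach-inside-component (reach-trans ax (step s e (here (reach-head ρ)))) ρ ya)

  sameComp-sym : ∀ {X x y} → SameComp D X x y → SameComp D X y x
  sameComp-sym (p , q) = q , p

  sameComp-trans : ∀ {X x y z} → SameComp D X x y → SameComp D X y z → SameComp D X x z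
  sameComp-trans (p , q) (p′ , q′) = reach-trans p p′ , reach-trans q′ q

  sameComp-antitone : ∀ {X Y x y} → Y ⊆ X → SameComp D X x y → SameComp D Y x y
  sameComp-antitone Y⊆X (p , q) = reach-map (λ u∉X u∈Y → u∉X (Y⊆X u∈Y)) p , reach-map (λ u∉X u∈Y → u∉X (Y⊆X u∈Y)) q

  sameComp-delete-outside : ∀ {X Z c d} → (∀ {u} → SameComp D X c u → u ∉ Z) →
    SameComp D X c d → SameComp D (Z ++ X) c d
  sameComp-delete-outside {X} {Z} {c} h (p , q) =
    reach-map avoid (reach-inside-component (here (reach-head p)) p q) ,
    reach-map avoid (reach-inside-component p q (here (reach-head p)))
    where
      avoid : ∀ {u} → u ∉ X × Reach D (Outside X) c u × Reach D (Outside X) u c → u ∉ Z ++ X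
      avoid (u∉X , cu , uc) u∈Z++X with ∈-++⁻ Z u∈Z++X
      ... | inj₁ u∈Z = h (cu , uc) u∈Z
      ... | inj₂ u∈X = u∉X u∈X

  module _ (R : Ray D) where

    inC-sameComp : ∀ {X a b} → InC D X R a → InC D X R b → SameComp D X a b
    inC-sameComp (n , t , s) (n′ , t′ , s′) =
      sameComp-trans (sameComp-sym s)
        (sameComp-trans (t _ (m≤m⊔n n n′)) (sameComp-trans (sameComp-sym (t′ _ (m≤n⊔m n n′))) s′))

    inC-closed : ∀ {X a b} → InC D X R a → SameComp D X a b → InC D X R b
    inC-closed (n , t , s) ab = n , t , sameComp-trans s ab

    inC-∉ : ∀ {X a} → InC D X R a → a ∉ X
    inC-∉ (_ , _ , s) = reach-last (proj₁ s)

    tail-inC : ∀ {X n k} → TailIn D X R n → n ≤ k → InC D X R (vtx R k)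
    tail-inC tail n≤k = _ , tail , tail _ n≤k

    inC-antitone : ∀ {X Y a} → Y ⊆ X → InC D X R a → InC D Y R a
    inC-antitone Y⊆X (n , t , s) = n , (λ m n≤m → sameComp-antitone Y⊆X (t m n≤m)) , sameComp-antitone Y⊆X s

    inC-delete-outside : ∀ {X Z a} → (∀ {z} → z ∈ Z → ¬ InC D X R z) → InC D X R a → InC D (Z ++ X) R a
    inC-delete-outside {X} {Z} h (n , t , s) =
      n , (λ m n≤m → sameComp-delete-outside h′ (t m n≤m)) , sameComp-delete-outside h′ s
      where
        h′ : ∀ {u} → SameComp D X (vtx R n) u → u ∉ Z
        h′ sc z∈Z = h z∈Z (n , t , sc)

  -- A walk  Walk x y l  lists its vertices except the last one, y.
  data Walk : V D → V D → List (V D) → Set where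
    []  : ∀ {x} → Walk x x []
    _∷_ : ∀ {x y z l} → E D x y → Walk y z l → Walk x z (x ∷ l)

  walk-++ : ∀ {x y z l l′} → Walk x y l → Walk y z l′ → Walk x z (l ++ l′)
  walk-++ []      w′ = w′
  walk-++ (e ∷ w) w′ = e ∷ walk-++ w w′

  reach⇒walk : ∀ {S x y} → Reach D S x y → ∃ λ l → Walk x y l × (∀ {u} → u ∈ l → S u)
  reach⇒walk (here s) = [] , [] , λ ()
  reach⇒walk (step s e ρ) with reach⇒walk ρ
  ... | l , w , inS = _ , e ∷ w , λ { (here refl) → s ; (there u∈l) → inS u∈l }

  walk-first∈ : ∀ {x y l} → Walk x y l → x ∈ l ++ [ y ]
  walk-first∈ []      = here refl
  walk-first∈ (_ ∷ _) = here refl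

  walk-through : ∀ {x y l u} → Walk x y l → u ∈ l ++ [ y ] →
    Reach D (_∈ l ++ [ y ]) x u × Reach D (_∈ l ++ [ y ]) u y
  walk-through []      (here refl) = here (here refl) , here (here refl)
  walk-through (e ∷ w) (here refl) =
    here (here refl) , step (here refl) e (reach-map there (proj₂ (walk-through w (walk-first∈ w))))
  walk-through (e ∷ w) (there u∈) =
    step (here refl) e (reach-map there (proj₁ (walk-through w u∈))) , reach-map there (proj₂ (walk-through w u∈))

  walk-head : ∀ {a b l} r → Walk a b l → lookupOr a (l ++ b ∷ r) 0 ≡ a
  walk-head r []      = refl
  walk-head r (_ ∷ _) = refl

  walk-prefix : ∀ {x y l u} → Walk x y l → u ∈ l → Reach D (_∈ l) x u
  walk-prefix (e ∷ w) (here refl) = here (here refl)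
  walk-prefix (e ∷ w) (there u∈) = step (here refl) e (reach-map there (walk-prefix w u∈))

  walk-suffix : ∀ {a b l u} → Walk a b (a ∷ l) → u ∈ l → Reach D (_∈ l ++ [ b ]) u b
  walk-suffix (e ∷ w) u∈ = proj₂ (walk-through w (∈-++⁺ˡ u∈))

  closed-walk-strong : ∀ {b l x y} → Walk b b l → x ∈ l ++ [ b ] → y ∈ l ++ [ b ] →
    Reach D (_∈ l ++ [ b ]) x y
  closed-walk-strong w x∈ y∈ = reach-trans (proj₂ (walk-through w x∈)) (proj₁ (walk-through w y∈))

  walk-from : ∀ {a z l u} → Walk a z l → Unique (l ++ [ z ]) → u ∈ l →
    ∃ λ l′ → Walk u z l′ × Unique (l′ ++ [ z ]) × l′ ⊆ l
  walk-from (e ∷ w) un       (here refl) = _ , e ∷ w , un , λ t∈ → t∈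
  walk-from (e ∷ w) (_ ∷ un) (there u∈)  with walk-from w un u∈
  ... | l′ , w′ , un′ , l′⊆ = l′ , w′ , un′ , λ t∈ → there (l′⊆ t∈)

  walk-linked : ∀ {x y l r} → Walk x y l → Linked (E D) (y ∷ r) → Linked (E D) (l ++ y ∷ r)
  walk-linked []            lk = lk
  walk-linked (e ∷ [])      lk = e ∷ lk
  walk-linked (e ∷ e′ ∷ w)  lk = e ∷ walk-linked (e′ ∷ w) lk

  linked⇒walk : ∀ a m c → Linked (E D) (a ∷ m ++ [ c ]) → Walk a c (a ∷ m)
  linked⇒walk a []      c (e ∷ [-]) = e ∷ []
  linked⇒walk a (b ∷ m) c (e ∷ lk)  = e ∷ linked⇒walk b m c lk

  consec-edge : ∀ {l x y} → Linked (E D) l → Consec D l x y → E D x y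
  consec-edge {a ∷ b ∷ l} (e ∷ _)  (inj₁ (refl , refl)) = e
  consec-edge {a ∷ b ∷ l} (_ ∷ lk) (inj₂ c)             = consec-edge lk c

  consec-∈ : ∀ {l x y} → Consec D l x y → x ∈ l × y ∈ l
  consec-∈ {a ∷ b ∷ l} (inj₁ (refl , refl)) = here refl , there (here refl)
  consec-∈ {a ∷ b ∷ l} (inj₂ c)             = there (proj₁ (consec-∈ c)) , there (proj₂ (consec-∈ c))

  consec-split : ∀ {a x l r u w} → Walk a x l → Consec D (l ++ x ∷ r) u w →
    Consec D (l ++ [ x ]) u w ⊎ Consec D (x ∷ r) u w
  consec-split []           c        = inj₂ c
  consec-split (e ∷ [])     (inj₁ q) = inj₁ (inj₁ q)
  consec-split (e ∷ [])     (inj₂ c) = inj₂ c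
  consec-split (e ∷ e′ ∷ w) (inj₁ q) = inj₁ (inj₁ q)
  consec-split (e ∷ e′ ∷ w) (inj₂ c) with consec-split (e′ ∷ w) c
  ... | inj₁ c′ = inj₁ (inj₂ c′)
  ... | inj₂ c′ = inj₂ c′

  consec-lookupOr : ∀ d l z j → j < length l →
    Consec D (l ++ [ z ]) (lookupOr d l j) (lookupOr z (l ++ [ z ]) (suc j))
  consec-lookupOr d (a ∷ [])    z zero    _       = inj₁ (refl , refl)
  consec-lookupOr d (a ∷ b ∷ l) z zero    _       = inj₁ (refl , refl)
  consec-lookupOr d (a ∷ b ∷ l) z (suc j) (s≤s p) = inj₂ (consec-lookupOr d (b ∷ l) z j p)
  consec-lookupOr d (a ∷ [])    z (suc j) (s≤s ())

  -- The ray runs through σ 0, σ 1, … in order; h i is the first vertex of σ i.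
  module ConcatRay (σ : ℕ → List (V D)) (h : ℕ → V D)
    (σ-nonempty : ∀ i → 0 < length (σ i))
    (σ-head     : ∀ i → lookupOr (h i) (σ i) 0 ≡ h i)
    (σ-unique   : ∀ i → Unique (σ i))
    (σ-disjoint : ∀ i j → i ≢ j → ∀ {x} → x ∈ σ i → x ∈ σ j → ⊥)
    (σ-linked   : ∀ i → Linked (E D) (σ i ++ [ h (suc i) ])) where

    Position : Set
    Position = ℕ × ℕ

    Valid : Position → Set
    Valid (i , j) = j < length (σ i)

    vertexAt : Position → V D
    vertexAt (i , j) = lookupOr (h i) (σ i) j

    next : Position → Position
    next (i , j) with suc j <? length (σ i)
    ... | yes _ = i , suc j
    ... | no  _ = suc i , 0

    next-valid : ∀ p → Valid p → Valid (next p)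
    next-valid (i , j) _ with suc j <? length (σ i)
    ... | yes q = q
    ... | no  _ = σ-nonempty (suc i)

    offset : ℕ → ℕ
    offset zero    = 0
    offset (suc i) = offset i + length (σ i)

    index : Position → ℕ
    index (i , j) = offset i + j

    index-next : ∀ p → Valid p → index (next p) ≡ suc (index p)
    index-next (i , j) valid with suc j <? length (σ i)
    ... | yes _ = +-suc (offset i) j
    ... | no  q = begin
      offset i + length (σ i) + 0 ≡⟨ +-identityʳ _ ⟩
      offset i + length (σ i)     ≡⟨ cong (offset i +_) (≤-antisym (≮⇒≥ q) valid) ⟩
      offset i + suc j            ≡⟨ +-suc (offset i) j ⟩
      suc (offset i + j)          ∎
      where open ≡-Reasoning

    consec-next : ∀ p → Valid p →
      Consec D (σ (proj₁ p) ++ [ h (suc (proj₁ p)) ]) (vertexAt p) (vertexAt (next p))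
    consec-next (i , j) valid with suc j <? length (σ i)
    ... | yes q = subst (Consec D (σ i ++ [ h (suc i) ]) (vertexAt (i , j)))
                    (lookupOr-++ˡ (h (suc i)) (h i) (σ i) [ h (suc i) ] (suc j) q)
                    (consec-lookupOr (h i) (σ i) (h (suc i)) j valid)
    ... | no  q = subst (Consec D (σ i ++ [ h (suc i) ]) (vertexAt (i , j)))
                    (trans last-is-next-head (sym (σ-head (suc i))))
                    (consec-lookupOr (h i) (σ i) (h (suc i)) j valid)
      where
        last-is-next-head : lookupOr (h (suc i)) (σ i ++ [ h (suc i) ]) (suc j) ≡ h (suc i)
        last-is-next-head = subst (λ k → lookupOr (h (suc i)) (σ i ++ [ h (suc i) ]) k ≡ h (suc i))
          (≤-antisym (≮⇒≥ q) valid) (lookupOr-length (h (suc i)) (σ i) (h (suc i)))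

    position : ℕ → Position
    position zero    = 0 , 0
    position (suc n) = next (position n)

    position-valid : ∀ n → Valid (position n)
    position-valid zero    = σ-nonempty 0
    position-valid (suc n) = next-valid (position n) (position-valid n)

    index-position : ∀ n → index (position n) ≡ n
    index-position zero    = refl
    index-position (suc n) = trans (index-next (position n) (position-valid n)) (cong suc (index-position n))

    vertexAt-injective : ∀ p q → Valid p → Valid q → vertexAt p ≡ vertexAt q → p ≡ q
    vertexAt-injective (i , j) (i′ , j′) vp vq eq with i ≟ i′
    ... | no  i≢i′ = ⊥-elim (σ-disjoint i i′ i≢i′ (subst (_∈ σ i) eq (lookupOr-∈ _ _ _ vp)) (lookupOr-∈ _ _ _ vq))
    ... | yes refl = cong (i ,_) (lookupOr-injective (h i) (σ i) j j′ (σ-unique i) vp vq eq)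

    ray : Ray D
    ray = record
      { vtx  = λ n → vertexAt (position n)
      ; inj  = λ m n eq → begin
          m                    ≡⟨ sym (index-position m) ⟩
          index (position m)   ≡⟨ cong index (vertexAt-injective _ _ (position-valid m) (position-valid n) eq) ⟩
          index (position n)   ≡⟨ index-position n ⟩
          n                    ∎
      ; edge = λ n → consec-edge (σ-linked _) (consec-next (position n) (position-valid n))
      }
      where open ≡-Reasoning

    ray-consec : ∀ n → Consec D (σ (proj₁ (position n)) ++ [ h (suc (proj₁ (position n))) ])
                                 (vtx ray n) (vtx ray (suc n))
    ray-consec n = consec-next (position n) (position-valid n)

  record Path (A B I : V D → Set) : Set where
    field
      first last : V D
      inner      : List (V D)
      walk       : Walk first last (first ∷ inner)
      unique     : Unique (first ∷ inner ++ [ last ])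
      first∈A    : A first
      last∈B     : B last
      inner⊆I    : ∀ {u} → u ∈ inner → I u

  retarget : ∀ {A B I A′ B′ I′} (p : Path A B I) → A′ (Path.first p) → B′ (Path.last p) →
    (∀ {u} → u ∈ Path.inner p → I′ u) → Path A′ B′ I′
  retarget p a b i = record
    { first = Path.first p ; last = Path.last p ; inner = Path.inner p ; walk = Path.walk p
    ; unique = Path.unique p ; first∈A = a ; last∈B = b ; inner⊆I = i }

  module _ (R : Ray D) where

    component-walk : ∀ {X a x y} → InC D X R a →
      Reach D (Outside X) a x → Reach D (Outside X) x y → Reach D (Outside X) y a →
      ∃ λ L → Walk x y L × (∀ {u} → u ∈ L → InC D X R u)
    component-walk a∈C ax xy ya with reach⇒walk (reach-inside-component ax xy ya)
    ... | L , w , L⊆ = L , w , λ u∈ → inC-closed R a∈C (proj₂ (L⊆ u∈))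

    closedWalk-via : ∀ {X b z} → InC D X R b → InC D X R z →
      ∃ λ L → Walk b b L × z ∈ L ++ [ b ] × (∀ {u} → u ∈ L → InC D X R u)
    closedWalk-via b∈C z∈C with inC-sameComp R b∈C z∈C
    ... | b⇝z , z⇝b
      with component-walk b∈C (here (inC-∉ R b∈C)) b⇝z z⇝b | component-walk b∈C b⇝z z⇝b (here (inC-∉ R b∈C))
    ...   | L₁ , w₁ , L₁⊆C | L₂ , w₂ , L₂⊆C =
      L₁ ++ L₂ , walk-++ w₁ w₂ , ∈-∷ʳ-++⁺ʳ L₁ L₂ (walk-first∈ w₂) , ∈-++-elim L₁ L₁⊆C L₂⊆C

    closedWalk-through : ∀ {X b} → InC D X R b → (zs : List (V D)) → (∀ {z} → z ∈ zs → InC D X R z) →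
      ∃ λ L → Walk b b L × zs ⊆ L ++ [ b ] × (∀ {u} → u ∈ L → InC D X R u)
    closedWalk-through b∈C []       _     = [] , [] , (λ ()) , λ ()
    closedWalk-through b∈C (z ∷ zs) zs⊆C
      with closedWalk-via b∈C (zs⊆C (here refl)) | closedWalk-through b∈C zs (λ z∈ → zs⊆C (there z∈))
    ... | L₁ , w₁ , z∈ , L₁⊆C | L₂ , w₂ , zs⊆ , L₂⊆C =
      L₁ ++ L₂ , walk-++ w₁ w₂ ,
      (λ { (here refl) → ∈-∷ʳ-++⁺ˡ L₁ L₂ z∈ ; (there z∈zs) → ∈-∷ʳ-++⁺ʳ L₁ L₂ (zs⊆ z∈zs) }) ,
      ∈-++-elim L₁ L₁⊆C L₂⊆C

    bead-through : ∀ {X b} → InC D X R b → (zs : List (V D)) → (∀ {z} → z ∈ zs → InC D X R z) →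
      ∃ λ Y → b ∈ Y × zs ⊆ Y × (∀ {u} → u ∈ Y → InC D X R u) × (∀ {x y} → x ∈ Y → y ∈ Y → Reach D (_∈ Y) x y)
    bead-through b∈C zs zs⊆C with closedWalk-through b∈C zs zs⊆C
    ... | L , w , zs⊆ , L⊆C =
      L ++ [ _ ] , walk-first∈ w , zs⊆ , ∈-++-elim L L⊆C (λ { (here refl) → b∈C }) , closed-walk-strong w

  module _ (lem : ExcludedMiddle 0ℓ) where

    decide : (P : Set) → Dec P
    decide P = lem

    walk⇒path : ∀ {x y l} → Walk x y l → ∃ λ l′ → Walk x y l′ × Unique (l′ ++ [ y ]) × l′ ⊆ l
    walk⇒path [] = [] , [] , All.[] ∷ [] , λ ()
    walk⇒path {x} (_∷_ {z = y} e w) with walk⇒path w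
    ... | l′ , w′ , un′ , l′⊆ with decide (x ∈ l′ ++ [ y ])
    ... | no x∉ = x ∷ l′ , e ∷ w′ , ¬Any⇒All¬ _ x∉ ∷ un′ ,
                  λ { (here refl) → here refl ; (there t∈) → there (l′⊆ t∈) }
    ... | yes x∈ with ∈-++⁻ l′ x∈
    ...   | inj₂ (here refl) = [] , [] , All.[] ∷ [] , λ ()
    ...   | inj₁ x∈l′ with walk-from w′ un′ x∈l′
    ...     | l″ , w″ , un″ , l″⊆ = l″ , w″ , un″ , λ t∈ → there (l′⊆ (l″⊆ t∈))

    module Extraction (A B S : V D → Set) (A∩B=∅ : ∀ {u} → A u → ¬ B u) where

      Interior : V D → Set
      Interior u = S u × ¬ A u × ¬ B u

      Trail : V D → Set
      Trail z = ∃ λ a → ∃ λ m → A a × Walk a z (a ∷ m) × (∀ {u} → u ∈ m → Interior u)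

      -- While scanning a walk we remember the trail from the last A-vertex seen.
      Scan : V D → Set
      Scan z = A z ⊎ (Interior z × Trail z)

      extend : ∀ {z z′} → E D z z′ → Scan z → Trail z′
      extend e (inj₁ az) = _ , [] , az , e ∷ [] , λ ()
      extend {z} e (inj₂ (iz , a , m , aa , w , m-I)) = a , m ++ [ z ] , aa , walk-++ w (e ∷ []) , m++z-I
        where
          m++z-I : ∀ {u} → u ∈ m ++ [ z ] → Interior u
          m++z-I u∈ with ∈-++⁻ m u∈
          ... | inj₁ u∈m         = m-I u∈m
          ... | inj₂ (here refl) = iz

      scan : ∀ {z y l} → Walk z y l → B y → (∀ {u} → u ∈ l ++ [ y ] → S u) → Scan z →
        ∃ λ b → B b × Trail b
      scan []                 by _   (inj₁ az)               = ⊥-elim (A∩B=∅ az by)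
      scan []                 by _   (inj₂ ((_ , _ , ¬b) , _)) = ⊥-elim (¬b by)
      scan (_∷_ {y = z′} e w) by inS sc with decide (B z′) | decide (A z′)
      ... | yes bz′ | _       = z′ , bz′ , extend e sc
      ... | no ¬bz′ | yes az′ = scan w by (λ u∈ → inS (there u∈)) (inj₁ az′)
      ... | no ¬bz′ | no ¬az′ =
        scan w by (λ u∈ → inS (there u∈)) (inj₂ ((inS (there (walk-first∈ w)) , ¬az′ , ¬bz′) , extend e sc))

      extract : ∀ {x y l} → Walk x y l → A x → B y → (∀ {u} → u ∈ l ++ [ y ] → S u) → Path A B Interior
      extract w ax by inS with scan w by inS (inj₁ ax)
      ... | b , bb , a , m , aa , wa , m-I with walk⇒path wa
      ...   | [] , [] , _ , _ = ⊥-elim (A∩B=∅ aa bb)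
      ...   | _ ∷ inner , e ∷ w′ , un , ⊆a∷m = record
        { first = a ; last = b ; inner = inner ; walk = e ∷ w′ ; unique = un
        ; first∈A = aa ; last∈B = bb ; inner⊆I = inner⊆I }
        where
          inner⊆I : ∀ {u} → u ∈ inner → Interior u
          inner⊆I u∈ with ⊆a∷m (there u∈)
          ... | here refl = ⊥-elim (head∉tail un (∈-++⁺ˡ u∈))
          ... | there u∈m = m-I u∈m

    index-bound : (P : ℕ → Set) → (∀ {i j} → P i → P j → i ≡ j) → ∃ λ b → ∀ {j} → P j → j < b
    index-bound P unique with decide (∃ P)
    ... | yes (i , pi) = suc i , λ pj → subst (_< suc i) (unique pi pj) (n<1+n i)
    ... | no  ¬∃P      = 0 , λ pj → ⊥-elim (¬∃P (_ , pj))

    eventually-∉ : ∀ {A : Set} (s : ℕ → A) → (∀ i j → s i ≡ s j → i ≡ j) → (F : List A) →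
      ∃ λ n₀ → ∀ n → n₀ ≤ n → s n ∉ F
    eventually-∉ s s-inj [] = 0 , λ _ _ ()
    eventually-∉ s s-inj (f ∷ F) with eventually-∉ s s-inj F | decide (∃ λ k → s k ≡ f)
    ... | n₀ , late∉F | no ¬hit = n₀ , late∉f∷F
      where
        late∉f∷F : ∀ n → n₀ ≤ n → s n ∉ f ∷ F
        late∉f∷F n _   (here eq)  = ¬hit (n , eq)
        late∉f∷F n n₀≤ (there s∈) = late∉F n n₀≤ s∈
    ... | n₀ , late∉F | yes (k , sk≡f) = suc k ⊔ n₀ , late∉f∷F
      where
        late∉f∷F : ∀ n → suc k ⊔ n₀ ≤ n → s n ∉ f ∷ F
        late∉f∷F n ≤n (here eq)  =
          <-irrefl (sym (s-inj n k (trans eq (sym sk≡f)))) (≤-trans (m≤m⊔n (suc k) n₀) ≤n)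
        late∉f∷F n ≤n (there s∈) = late∉F n (≤-trans (m≤n⊔m (suc k) n₀) ≤n) s∈

    module NecklaceFacts (N : Necklace D) where

      Beyond : ℕ → V D → Set
      Beyond K x = (∃ λ i → K ≤ i × x ∈ bead N i) ⊎ (∃ λ p → K ≤ proj₁ p × x ∈ inner N p)

      pathWalk : ∀ p → Walk (start N p) (stop N p) (start N p ∷ inner N p)
      pathWalk p = linked⇒walk _ _ _ (path-edges N p)

      -- Beads are strong and consecutive beads are joined both ways, so everything beyond K
      -- is strongly connected to the start of the path leaving Y_K.
      module Connected (X : List (V D)) (K : ℕ) (beyond-∉ : ∀ {x} → Beyond K x → x ∉ X) where

        bead-reach : ∀ {i x y} → K ≤ i → x ∈ bead N i → y ∈ bead N i → Reach D (Outside X) x y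
        bead-reach K≤i x∈ y∈ = reach-map (λ u∈ → beyond-∉ (inj₁ (_ , K≤i , u∈))) (bead-strong N _ _ _ x∈ y∈)

        from-beyond : ∀ p → K ≤ proj₁ p → K ≤ from D p
        from-beyond (i , true)  K≤i = K≤i
        from-beyond (i , false) K≤i = ≤-trans K≤i (n≤1+n i)

        to-beyond : ∀ p → K ≤ proj₁ p → K ≤ to D p
        to-beyond (i , true)  K≤i = ≤-trans K≤i (n≤1+n i)
        to-beyond (i , false) K≤i = K≤i

        path-reach : ∀ p → K ≤ proj₁ p → ∀ {u} → u ∈ (start N p ∷ inner N p) ++ [ stop N p ] →
          Reach D (Outside X) (start N p) u × Reach D (Outside X) u (stop N p)
        path-reach p K≤ u∈ =
          reach-map on-path (proj₁ (walk-through (pathWalk p) u∈)) ,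
          reach-map on-path (proj₂ (walk-through (pathWalk p) u∈))
          where
            on-path : ∀ {u} → u ∈ (start N p ∷ inner N p) ++ [ stop N p ] → u ∉ X
            on-path (here refl) = beyond-∉ (inj₁ (_ , from-beyond p K≤ , start-in N p))
            on-path (there u∈) with ∈-++⁻ (inner N p) u∈
            ... | inj₁ u∈inner    = beyond-∉ (inj₂ (p , K≤ , u∈inner))
            ... | inj₂ (here refl) = beyond-∉ (inj₁ (_ , to-beyond p K≤ , stop-in N p))

        path-start⇝stop : ∀ p → K ≤ proj₁ p → Reach D (Outside X) (start N p) (stop N p)
        path-start⇝stop p K≤ = proj₁ (path-reach p K≤ (∈-++⁺ʳ (start N p ∷ inner N p) (here refl)))

        hub : V D
        hub = start N (K , true)

        bead-sameComp-hub : ∀ d {x} → x ∈ bead N (d + K) → SameComp D X hub x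
        bead-sameComp-hub zero x∈ =
          bead-reach ≤-refl (start-in N (K , true)) x∈ , bead-reach ≤-refl x∈ (start-in N (K , true))
        bead-sameComp-hub (suc d) x∈ =
          reach-trans (proj₁ (bead-sameComp-hub d (start-in N (d + K , true))))
            (reach-trans (path-start⇝stop (d + K , true) K≤)
              (bead-reach K≤suc (stop-in N (d + K , true)) x∈)) ,
          reach-trans (bead-reach K≤suc x∈ (start-in N (d + K , false)))
            (reach-trans (path-start⇝stop (d + K , false) K≤)
              (proj₂ (bead-sameComp-hub d (stop-in N (d + K , false)))))
          where
            K≤ : K ≤ d + K
            K≤ = m≤n+m K d
            K≤suc : K ≤ suc (d + K)
            K≤suc = ≤-trans K≤ (n≤1+n _)

        bead-beyond-sameComp-hub : ∀ {i x} → K ≤ i → x ∈ bead N i → SameComp D X hub x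
        bead-beyond-sameComp-hub {i} {x} K≤i x∈ =
          bead-sameComp-hub (i ∸ K) (subst (λ j → x ∈ bead N j) (sym (m∸n+n≡m K≤i)) x∈)

        beyond-sameComp-hub : ∀ {x} → Beyond K x → SameComp D X hub x
        beyond-sameComp-hub (inj₁ (i , K≤i , x∈)) = bead-beyond-sameComp-hub K≤i x∈
        beyond-sameComp-hub {x} (inj₂ (p , K≤ , x∈)) =
          reach-trans (proj₁ (bead-beyond-sameComp-hub (from-beyond p K≤) (start-in N p))) (proj₁ (path-reach p K≤ x∈′)) ,
          reach-trans (proj₂ (path-reach p K≤ x∈′)) (proj₂ (bead-beyond-sameComp-hub (to-beyond p K≤) (stop-in N p)))
          where
            x∈′ : x ∈ (start N p ∷ inner N p) ++ [ stop N p ]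
            x∈′ = there (∈-++⁺ˡ x∈)

        beyond-sameComp : ∀ {x y} → Beyond K x → Beyond K y → SameComp D X x y
        beyond-sameComp bx by = sameComp-trans (sameComp-sym (beyond-sameComp-hub bx)) (beyond-sameComp-hub by)

      bead-index-unique : ∀ {x i j} → x ∈ bead N i → x ∈ bead N j → i ≡ j
      bead-index-unique {x} {i} {j} x∈i x∈j with i ≟ j
      ... | yes i≡j = i≡j
      ... | no  i≢j = ⊥-elim (bead-disj N i j i≢j x x∈i x∈j)

      inner-index-unique : ∀ {x i j} → (∃ λ b → x ∈ inner N (i , b)) → (∃ λ b → x ∈ inner N (j , b)) → i ≡ j
      inner-index-unique {x} {i} {j} (b , x∈i) (b′ , x∈j) with i ≟ j
      ... | yes i≡j = i≡j
      ... | no  i≢j = ⊥-elim (inner-disj N (i , b) (j , b′) (λ eq → i≢j (cong proj₁ eq)) x x∈i x∈j)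

      beadBound : V D → ℕ
      beadBound x = proj₁ (index-bound (λ i → x ∈ bead N i) bead-index-unique)

      <-beadBound : ∀ {x i} → x ∈ bead N i → i < beadBound x
      <-beadBound {x} = proj₂ (index-bound (λ i → x ∈ bead N i) bead-index-unique)

      innerBound : V D → ℕ
      innerBound x = proj₁ (index-bound (λ i → ∃ λ b → x ∈ inner N (i , b)) inner-index-unique)

      <-innerBound : ∀ {x i b} → x ∈ inner N (i , b) → i < innerBound x
      <-innerBound {x} {b = b} x∈ = proj₂ (index-bound (λ i → ∃ λ b → x ∈ inner N (i , b)) inner-index-unique) (b , x∈)

      bound : List (V D) → ℕ
      bound = maxOver (λ x → beadBound x ⊔ innerBound x)

      beyond-bound-∉ : ∀ X {x} → Beyond (bound X) x → x ∉ X
      beyond-bound-∉ X (inj₁ (i , K≤i , x∈)) x∈X =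
        <⇒≱ (<-≤-trans (<-beadBound x∈) (≤-trans (m≤m⊔n _ _) (≤-maxOver _ x∈X))) K≤i
      beyond-bound-∉ X (inj₂ ((i , b) , K≤i , x∈)) x∈X =
        <⇒≱ (<-≤-trans (<-innerBound x∈) (≤-trans (m≤n⊔m _ _) (≤-maxOver _ x∈X))) K≤i

      beyond-bound-sameComp : ∀ X {x y} → Beyond (bound X) x → Beyond (bound X) y → SameComp D X x y
      beyond-bound-sameComp X = Connected.beyond-sameComp X (bound X) (beyond-bound-∉ X)

      OnNecklace : V D → Set
      OnNecklace x = (∃ λ i → x ∈ bead N i) ⊎ (∃ λ p → x ∈ inner N p)

      edgeN-source : ∀ {x y} → EdgeN D N x y → OnNecklace x
      edgeN-source (inj₁ (i , x∈ , _ , _)) = inj₁ (i , x∈)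
      edgeN-source (inj₂ (p , c)) with proj₁ (consec-∈ c)
      ... | here refl = inj₁ (from D p , start-in N p)
      ... | there x∈ with ∈-++⁻ (inner N p) x∈
      ...   | inj₁ x∈inner    = inj₂ (p , x∈inner)
      ...   | inj₂ (here refl) = inj₁ (to D p , stop-in N p)

      early : ℕ → List (V D)
      early zero    = []
      early (suc i) = bead N i ++ inner N (i , true) ++ inner N (i , false) ++ early i

      early-++⁺ : ∀ {i x} → x ∈ early i → x ∈ early (suc i)
      early-++⁺ {i} x∈ = ∈-++⁺ʳ (bead N i) (∈-++⁺ʳ (inner N (i , true)) (∈-++⁺ʳ (inner N (i , false)) x∈))

      bead-early : ∀ {i K x} → suc i ≤′ K → x ∈ bead N i → x ∈ early K
      bead-early ≤′-refl      x∈ = ∈-++⁺ˡ x∈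
      bead-early (≤′-step i<K) x∈ = early-++⁺ (bead-early i<K x∈)

      inner-early : ∀ {p K x} → suc (proj₁ p) ≤′ K → x ∈ inner N p → x ∈ early K
      inner-early {i , true}  ≤′-refl x∈ = ∈-++⁺ʳ (bead N i) (∈-++⁺ˡ x∈)
      inner-early {i , false} ≤′-refl x∈ = ∈-++⁺ʳ (bead N i) (∈-++⁺ʳ (inner N (i , true)) (∈-++⁺ˡ x∈))
      inner-early {p} (≤′-step i<K) x∈ = early-++⁺ (inner-early {p} i<K x∈)

      beyond-unless-early : ∀ K {x} → OnNecklace x → x ∉ early K → Beyond K x
      beyond-unless-early K (inj₁ (i , x∈)) x∉ with K ≤? i
      ... | yes K≤i = inj₁ (i , K≤i , x∈)
      ... | no  K≰i = ⊥-elim (x∉ (bead-early (≤⇒≤′ (≰⇒> K≰i)) x∈))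
      beyond-unless-early K (inj₂ (p , x∈)) x∉ with K ≤? proj₁ p
      ... | yes K≤i = inj₂ (p , K≤i , x∈)
      ... | no  K≰i = ⊥-elim (x∉ (inner-early {p} (≤⇒≤′ (≰⇒> K≰i)) x∈))

      rayIn-eventually-beyond : (S : Ray D) → RayIn D N S → ∀ K → ∃ λ n₀ → ∀ n → n₀ ≤ n → Beyond K (vtx S n)
      rayIn-eventually-beyond S S-in K with eventually-∉ (vtx S) (inj S) (early K)
      ... | n₀ , late∉ = n₀ , λ n n₀≤n → beyond-unless-early K (edgeN-source (S-in n)) (late∉ n n₀≤n)

      -- A late tail of the ray in N and the bead Y_K, K = bound X, lie in one strong component of D − X.
      limit-from-necklace : (R : Ray D) → Represents D N R → (P : V D → Set) →
        (∀ i → ∃ λ y → y ∈ bead N i × P y) → ∀ X → ∃ λ w → InC D X R w × P w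
      limit-from-necklace R (S , S-in , S~R) P beads-P X
        with S~R X | rayIn-eventually-beyond S S-in (bound X) | beads-P (bound X)
      ... | n , m , tailS , tailR , Sn~Rm | n₀ , late-beyond | y , y∈ , Py =
        y , (m , tailR , sameComp-trans (sameComp-sym Sn~Rm) (sameComp-trans (tailS (n ⊔ n₀) (m≤m⊔n n n₀)) S~y)) , Py
        where
          S~y : SameComp D X (vtx S (n ⊔ n₀)) y
          S~y = beyond-bound-sameComp X (late-beyond _ (m≤n⊔m n n₀)) (inj₁ (bound X , ≤-refl , y∈))

      entry : ℕ → V D
      entry zero    = start N (0 , true)
      entry (suc i) = stop N (i , true)

      entry-∈ : ∀ i → entry i ∈ bead N i
      entry-∈ zero    = start-in N (0 , true)
      entry-∈ (suc i) = stop-in N (i , true)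

      exit : ℕ → V D
      exit i = start N (i , true)

      beadPath : ∀ i → ∃ λ l → Walk (entry i) (exit i) l × Unique (l ++ [ exit i ]) × l ⊆ bead N i
      beadPath i with reach⇒walk (bead-strong N i (entry i) (exit i) (entry-∈ i) (start-in N (i , true)))
      ... | l , w , l⊆ with walk⇒path w
      ...   | l′ , w′ , un , l′⊆l = l′ , w′ , un , λ t∈ → l⊆ (l′⊆l t∈)

      throughBead : ℕ → List (V D)
      throughBead i = proj₁ (beadPath i)

      beadPath-walk : ∀ i → Walk (entry i) (exit i) (throughBead i)
      beadPath-walk i = proj₁ (proj₂ (beadPath i))

      beadPath-unique : ∀ i → Unique (throughBead i ++ [ exit i ])
      beadPath-unique i = proj₁ (proj₂ (proj₂ (beadPath i)))

      beadPath-⊆ : ∀ i → throughBead i ++ [ exit i ] ⊆ bead N i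
      beadPath-⊆ i u∈ with ∈-++⁻ (throughBead i) u∈
      ... | inj₁ u∈l         = proj₂ (proj₂ (proj₂ (beadPath i))) u∈l
      ... | inj₂ (here refl) = start-in N (i , true)

      segment : ℕ → List (V D)
      segment i = throughBead i ++ exit i ∷ inner N (i , true)

      segment-++ : ∀ i → segment i ++ [ entry (suc i) ] ≡
        throughBead i ++ exit i ∷ inner N (i , true) ++ [ stop N (i , true) ]
      segment-++ i = ++-assoc (throughBead i) (exit i ∷ inner N (i , true)) [ stop N (i , true) ]

      segment-⊆ : ∀ i {u} → u ∈ segment i → u ∈ bead N i ⊎ u ∈ inner N (i , true)
      segment-⊆ i u∈ with ∈-++⁻ (throughBead i) u∈
      ... | inj₁ u∈l          = inj₁ (beadPath-⊆ i (∈-++⁺ˡ u∈l))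
      ... | inj₂ (here refl)  = inj₁ (start-in N (i , true))
      ... | inj₂ (there u∈in) = inj₂ u∈in

      segment-unique : ∀ i → Unique (segment i)
      segment-unique i =
        unique-++-∷ (throughBead i) (beadPath-unique i)
          (unique-++⁻ˡ (exit i ∷ inner N (i , true)) (path-unique N (i , true)))
          (λ u∈l u∈in → inner-bead N (i , true) i _ u∈in (beadPath-⊆ i (∈-++⁺ˡ u∈l)))

      segment-disjoint : ∀ i j → i ≢ j → ∀ {x} → x ∈ segment i → x ∈ segment j → ⊥
      segment-disjoint i j i≢j {x} x∈i x∈j with segment-⊆ i x∈i | segment-⊆ j x∈j
      ... | inj₁ a | inj₁ b = bead-disj N i j i≢j x a b
      ... | inj₁ a | inj₂ b = inner-bead N (j , true) i x b a
      ... | inj₂ a | inj₁ b = inner-bead N (i , true) j x a b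
      ... | inj₂ a | inj₂ b = inner-disj N (i , true) (j , true) (λ eq → i≢j (cong proj₁ eq)) x a b

      segment-linked : ∀ i → Linked (E D) (segment i ++ [ entry (suc i) ])
      segment-linked i = subst (Linked (E D)) (sym (segment-++ i))
        (walk-linked (beadPath-walk i) (path-edges N (i , true)))

      segment-consec⇒edgeN : ∀ i {u w} → Consec D (segment i ++ [ entry (suc i) ]) u w → EdgeN D N u w
      segment-consec⇒edgeN i {u} {w} c with consec-split (beadPath-walk i) (subst (λ l → Consec D l u w) (segment-++ i) c)
      ... | inj₁ c′ = inj₁ (i , beadPath-⊆ i (proj₁ (consec-∈ c′)) , beadPath-⊆ i (proj₂ (consec-∈ c′)) ,
                            consec-edge (walk-linked (beadPath-walk i) [-]) c′)
      ... | inj₂ c′ = inj₂ ((i , true) , c′)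

      module NR = ConcatRay segment entry
        (λ i → ∈-length (∈-++⁺ʳ (throughBead i) (here refl)))
        (λ i → walk-head (inner N (i , true)) (beadPath-walk i))
        segment-unique segment-disjoint segment-linked

      -- opaque only to keep type checking fast: nothing below needs to unfold the ray
      opaque
        necklaceRay : Ray D
        necklaceRay = NR.ray

        necklaceRay-in : RayIn D N necklaceRay
        necklaceRay-in n = segment-consec⇒edgeN (proj₁ (NR.position n)) (NR.ray-consec n)

      MeetsLateBeads : Ray D → Set
      MeetsLateBeads R = ∀ K m → ∃ λ i → ∃ λ r → K ≤ i × m ≤ r × vtx R r ∈ bead N i

      -- Late tails of the necklace ray and of R both meet beads Y_i with i ≥ bound X.
      meetsLateBeads⇒represents : (R : Ray D) → Solid D R → MeetsLateBeads R → Represents D N R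
      meetsLateBeads⇒represents R R-solid meets = necklaceRay , necklaceRay-in , equiv
        where
          equiv : Equiv D necklaceRay R
          equiv X with rayIn-eventually-beyond necklaceRay necklaceRay-in (bound X) | R-solid X
          ... | n₀ , late-beyond | m , tailR with meets (bound X) m
          ...   | i , r , K≤i , m≤r , Rr∈ =
            n₀ , m , tailS , tailR ,
            sameComp-trans (beyond-bound-sameComp X (late-beyond n₀ ≤-refl) (inj₁ (i , K≤i , Rr∈)))
                           (sameComp-sym (tailR r m≤r))
            where
              tailS : TailIn D X necklaceRay n₀
              tailS n n₀≤n = beyond-bound-sameComp X (late-beyond n₀ ≤-refl) (late-beyond n n₀≤n)

    module Construction (R : Ray D) (v : V D) (P : V D → Set)
      (limit : ∀ X → v ∈ X → ∃ λ w → InC D X R w × P w) where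

      -- Y is the current bead and U the finite set deleted so far.
      record Stage : Set where
        field
          U Y      : List (V D)
          v∈U      : v ∈ U
          Y⊆C      : ∀ {u} → u ∈ Y → InC D U R u
          Y-strong : ∀ {x y} → x ∈ Y → y ∈ Y → Reach D (_∈ Y) x y
          depth    : ℕ
          R∈Y      : vtx R depth ∈ Y
          P∈Y      : ∃ λ w → w ∈ Y × P w
      open Stage

      Fresh : Stage → Stage → V D → Set
      Fresh s t u = u ∉ U s × u ∉ Y s × u ∉ Y t × u ∈ U t

      record Extension (s : Stage) (m : ℕ) : Set where
        field
          next     : Stage
          forth    : Path (_∈ Y s) (_∈ Y next) (Fresh s next)
          back     : Path (_∈ Y next) (_∈ Y s) (Fresh s next)
          disjoint : ∀ {u} → u ∈ Path.inner forth → u ∈ Path.inner back → ⊥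
          U⊆U      : U s ⊆ U next
          Y⊆U      : Y s ⊆ U next
          m≤depth  : m ≤ depth next

      initial : Stage
      initial with limit [ v ] (here refl)
      ... | w , w∈C@(n , tail , _) , Pw with bead-through R (tail-inC R tail ≤-refl) [ w ] (λ { (here refl) → w∈C })
      ...   | Y , Rn∈Y , w∈Y , Y⊆C , Y-strong = record
        { U = [ v ] ; Y = Y ; v∈U = here refl ; Y⊆C = Y⊆C ; Y-strong = Y-strong
        ; depth = n ; R∈Y = Rn∈Y ; P∈Y = w , w∈Y (here refl) , Pw }

      -- The limit condition for U₁ = Y ∪ U gives w ∈ C₁ = C(U₁, ω). A walk from Y to w and back inside
      -- C(U, ω) yields a Y–C₁ and a C₁–Y path with interiors outside C₁, hence disjoint; the next bead is a
      -- closed walk in C₁ through their ends, w and a late vertex of R. Deleting the interiors as well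
      -- keeps that bead inside the next C.
      module NextStage (s : Stage) (m : ℕ) where

        U₁ : List (V D)
        U₁ = Y s ++ U s

        C₁ : V D → Set
        C₁ = InC D U₁ R

        C₁⊆C : ∀ {u} → C₁ u → InC D (U s) R u
        C₁⊆C = inC-antitone R (∈-++⁺ʳ (Y s))

        C₁-∉Y : ∀ {u} → C₁ u → u ∉ Y s
        C₁-∉Y u∈C₁ u∈Y = inC-∉ R u∈C₁ (∈-++⁺ˡ u∈Y)

        ∉U₁ : ∀ {u} → u ∉ U s → u ∉ Y s → u ∉ U₁
        ∉U₁ u∉U u∉Y u∈ with ∈-++⁻ (Y s) u∈
        ... | inj₁ u∈Y = u∉Y u∈Y
        ... | inj₂ u∈U = u∉U u∈U

        w : V D
        w = proj₁ (limit U₁ (∈-++⁺ʳ (Y s) (v∈U s)))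

        w∈C₁ : C₁ w
        w∈C₁ = proj₁ (proj₂ (limit U₁ (∈-++⁺ʳ (Y s) (v∈U s))))

        Pw : P w
        Pw = proj₂ (proj₂ (limit U₁ (∈-++⁺ʳ (Y s) (v∈U s))))

        k : ℕ
        k = m + proj₁ w∈C₁

        Rk∈C₁ : C₁ (vtx R k)
        Rk∈C₁ = tail-inC R (proj₁ (proj₂ w∈C₁)) (m≤n+m _ m)

        Rd∼w : SameComp D (U s) (vtx R (depth s)) w
        Rd∼w = inC-sameComp R (Y⊆C s (R∈Y s)) (C₁⊆C w∈C₁)

        module Forth = Extraction (_∈ Y s) C₁ (Outside (U s)) (λ u∈Y u∈C₁ → C₁-∉Y u∈C₁ u∈Y)
        module Back  = Extraction C₁ (_∈ Y s) (Outside (U s)) (λ u∈C₁ u∈Y → C₁-∉Y u∈C₁ u∈Y)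

        -- opaque, like newBead below, only to keep type checking fast
        opaque
          forth₀ : Path (_∈ Y s) C₁ Forth.Interior
          forth₀ with reach⇒walk (proj₁ Rd∼w)
          ... | l , walk , l∉U =
            Forth.extract walk (R∈Y s) w∈C₁ (∈-++-elim l l∉U λ { (here refl) → inC-∉ R (C₁⊆C w∈C₁) })

          back₀ : Path C₁ (_∈ Y s) Back.Interior
          back₀ with reach⇒walk (proj₂ Rd∼w)
          ... | l , walk , l∉U =
            Back.extract walk w∈C₁ (R∈Y s) (∈-++-elim l l∉U λ { (here refl) → inC-∉ R (Y⊆C s (R∈Y s)) })

        -- A common interior vertex would be reachable from and reach C₁ avoiding U₁, hence lie in C₁.
        interiors-disjoint : ∀ {u} → u ∈ Path.inner forth₀ → u ∈ Path.inner back₀ → ⊥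
        interiors-disjoint {u} u∈forth u∈back =
          proj₂ (proj₂ (Path.inner⊆I forth₀ u∈forth)) (inC-closed R last∈C₁ (last⇝first-back-⇝u , u⇝last))
          where
            open Path
            last∈C₁ : C₁ (last forth₀)
            last∈C₁ = last∈B forth₀
            on-forth : ∀ {t} → t ∈ inner forth₀ ++ [ last forth₀ ] → t ∉ U₁
            on-forth = ∈-++-elim (inner forth₀)
              (λ t∈ → ∉U₁ (proj₁ (inner⊆I forth₀ t∈)) (proj₁ (proj₂ (inner⊆I forth₀ t∈))))
              (λ { (here refl) → inC-∉ R last∈C₁ })
            on-back : ∀ {t} → t ∈ first back₀ ∷ inner back₀ → t ∉ U₁
            on-back (here refl) = inC-∉ R (first∈A back₀)
            on-back (there t∈)  = ∉U₁ (proj₁ (inner⊆I back₀ t∈)) (proj₂ (proj₂ (inner⊆I back₀ t∈)))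
            u⇝last : Reach D (Outside U₁) u (last forth₀)
            u⇝last = reach-map on-forth (walk-suffix (walk forth₀) u∈forth)
            last⇝first-back-⇝u : Reach D (Outside U₁) (last forth₀) u
            last⇝first-back-⇝u = reach-trans (proj₁ (inC-sameComp R last∈C₁ (first∈A back₀)))
                                             (reach-map on-back (walk-prefix (walk back₀) (there u∈back)))

        anchors : List (V D)
        anchors = Path.last forth₀ ∷ Path.first back₀ ∷ w ∷ []

        anchors⊆C₁ : ∀ {z} → z ∈ anchors → C₁ z
        anchors⊆C₁ (here refl)                 = Path.last∈B forth₀
        anchors⊆C₁ (there (here refl))         = Path.first∈A back₀
        anchors⊆C₁ (there (there (here refl))) = w∈C₁

        opaque
          newBead : ∃ λ Y → vtx R k ∈ Y × anchors ⊆ Y × (∀ {u} → u ∈ Y → C₁ u) ×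
            (∀ {x y} → x ∈ Y → y ∈ Y → Reach D (_∈ Y) x y)
          newBead = bead-through R Rk∈C₁ anchors anchors⊆C₁

        Y′ : List (V D)
        Y′ = proj₁ newBead

        Y′⊆C₁ : ∀ {u} → u ∈ Y′ → C₁ u
        Y′⊆C₁ = proj₁ (proj₂ (proj₂ (proj₂ newBead)))

        anchors⊆Y′ : anchors ⊆ Y′
        anchors⊆Y′ = proj₁ (proj₂ (proj₂ newBead))

        interiors : List (V D)
        interiors = Path.inner forth₀ ++ Path.inner back₀

        interiors-∉C₁ : ∀ {u} → u ∈ interiors → ¬ C₁ u
        interiors-∉C₁ = ∈-++-elim (Path.inner forth₀)
          (λ u∈ → proj₂ (proj₂ (Path.inner⊆I forth₀ u∈)))
          (λ u∈ → proj₁ (proj₂ (Path.inner⊆I back₀ u∈)))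

        next : Stage
        next = record
          { U = interiors ++ U₁ ; Y = Y′
          ; v∈U = ∈-++⁺ʳ interiors (∈-++⁺ʳ (Y s) (v∈U s))
          ; Y⊆C = λ u∈ → inC-delete-outside R interiors-∉C₁ (Y′⊆C₁ u∈)
          ; Y-strong = proj₂ (proj₂ (proj₂ (proj₂ newBead)))
          ; depth = k ; R∈Y = proj₁ (proj₂ newBead)
          ; P∈Y = w , anchors⊆Y′ (there (there (here refl))) , Pw }

        fresh : ∀ {u} → u ∈ interiors → u ∉ U s → u ∉ Y s → Fresh s next u
        fresh u∈ u∉U u∉Y = u∉U , u∉Y , (λ u∈Y′ → interiors-∉C₁ u∈ (Y′⊆C₁ u∈Y′)) , ∈-++⁺ˡ u∈

        extension : Extension s m
        extension = record
          { next = next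
          ; forth = retarget forth₀ (Path.first∈A forth₀) (anchors⊆Y′ (here refl))
              (λ u∈ → fresh (∈-++⁺ˡ u∈) (proj₁ (Path.inner⊆I forth₀ u∈)) (proj₁ (proj₂ (Path.inner⊆I forth₀ u∈))))
          ; back = retarget back₀ (anchors⊆Y′ (there (here refl))) (Path.last∈B back₀)
              (λ u∈ → fresh (∈-++⁺ʳ (Path.inner forth₀) u∈) (proj₁ (Path.inner⊆I back₀ u∈))
                            (proj₂ (proj₂ (Path.inner⊆I back₀ u∈))))
          ; disjoint = interiors-disjoint
          ; U⊆U = λ u∈ → ∈-++⁺ʳ interiors (∈-++⁺ʳ (Y s) u∈)
          ; Y⊆U = λ u∈ → ∈-++⁺ʳ interiors (∈-++⁺ˡ u∈)
          ; m≤depth = m≤m+n m _ }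

      stage : ℕ → Stage
      extension : (i : ℕ) → Extension (stage i) (suc i)
      stage zero    = initial
      stage (suc i) = Extension.next (extension i)
      extension i   = NextStage.extension (stage i) (suc i)

      beadAt : ℕ → List (V D)
      beadAt i = Y (stage i)

      U-mono′ : ∀ {i j} → i ≤′ j → U (stage i) ⊆ U (stage j)
      U-mono′ ≤′-refl       u∈ = u∈
      U-mono′ (≤′-step i≤j) u∈ = Extension.U⊆U (extension _) (U-mono′ i≤j u∈)

      U-mono : ∀ {i j} → i ≤ j → U (stage i) ⊆ U (stage j)
      U-mono i≤j = U-mono′ (≤⇒≤′ i≤j)

      bead⊆U-later : ∀ {i j} → i < j → beadAt i ⊆ U (stage j)
      bead⊆U-later {i} i<j u∈ = U-mono i<j (Extension.Y⊆U (extension i) u∈)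

      bead-∉U : ∀ i {u} → u ∈ beadAt i → u ∉ U (stage i)
      bead-∉U i u∈ = inC-∉ R (Y⊆C (stage i) u∈)

      beads-disjoint : ∀ i j → i ≢ j → ∀ x → x ∈ beadAt i → x ∈ beadAt j → ⊥
      beads-disjoint i j i≢j x x∈i x∈j with <-cmp i j
      ... | tri< i<j _ _ = bead-∉U j x∈j (bead⊆U-later i<j x∈i)
      ... | tri≈ _ i≡j _ = i≢j i≡j
      ... | tri> _ _ j<i = bead-∉U i x∈i (bead⊆U-later j<i x∈j)

      link : (p : PIdx D) →
        Path (_∈ beadAt (from D p)) (_∈ beadAt (to D p)) (Fresh (stage (proj₁ p)) (stage (suc (proj₁ p))))
      link (i , true)  = Extension.forth (extension i)
      link (i , false) = Extension.back (extension i)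

      link-inner-∉bead : ∀ p j {x} → x ∈ Path.inner (link p) → x ∉ beadAt j
      link-inner-∉bead (i , b) j x∈ x∈Yj with Path.inner⊆I (link (i , b)) x∈ | <-cmp j i
      ... | x∉Uᵢ , _ , _ , _ | tri< j<i _ _ = x∉Uᵢ (bead⊆U-later j<i x∈Yj)
      ... | _ , x∉Yᵢ , _ , _ | tri≈ _ refl _ = x∉Yᵢ x∈Yj
      ... | _ , _ , x∉Yᵢ₊₁ , x∈Uᵢ₊₁ | tri> _ _ i<j with ≤⇒≤′ i<j
      ...   | ≤′-refl        = x∉Yᵢ₊₁ x∈Yj
      ...   | ≤′-step i+1<j = bead-∉U j x∈Yj (U-mono′ (≤′-step i+1<j) x∈Uᵢ₊₁)

      link-inners-disjoint : ∀ p q → p ≢ q → ∀ {x} → x ∈ Path.inner (link p) → x ∈ Path.inner (link q) → ⊥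
      link-inners-disjoint p q p≢q x∈p x∈q
        with Path.inner⊆I (link p) x∈p | Path.inner⊆I (link q) x∈q | <-cmp (proj₁ p) (proj₁ q)
      ... | _ , _ , _ , x∈Up | x∉Uq , _ | tri< p<q _ _ = x∉Uq (U-mono p<q x∈Up)
      ... | x∉Up , _ | _ , _ , _ , x∈Uq | tri> _ _ q<p = x∉Up (U-mono q<p x∈Uq)
      link-inners-disjoint (i , true)  (.i , true)  p≢q _   _   | _ | _ | tri≈ _ refl _ = p≢q refl
      link-inners-disjoint (i , true)  (.i , false) _   x∈p x∈q | _ | _ | tri≈ _ refl _ = Extension.disjoint (extension i) x∈p x∈q
      link-inners-disjoint (i , false) (.i , true)  _   x∈p x∈q | _ | _ | tri≈ _ refl _ = Extension.disjoint (extension i) x∈q x∈p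
      link-inners-disjoint (i , false) (.i , false) p≢q _   _   | _ | _ | tri≈ _ refl _ = p≢q refl

      from≢to : ∀ p → from D p ≢ to D p
      from≢to (i , true)  i≡1+i = 1+n≢n (sym i≡1+i)
      from≢to (i , false) 1+i≡i = 1+n≢n 1+i≡i

      necklace : Necklace D
      necklace = record
        { bead        = beadAt
        ; bead-strong = λ i x y → Y-strong (stage i)
        ; bead-disj   = beads-disjoint
        ; start       = λ p → Path.first (link p)
        ; inner       = λ p → Path.inner (link p)
        ; stop        = λ p → Path.last (link p)
        ; path-edges  = λ p → walk-linked (Path.walk (link p)) [-]
        ; path-unique = λ p → Path.unique (link p)
        ; start-in    = λ p → Path.first∈A (link p)
        ; start-out   = λ p x∈ → beads-disjoint _ _ (from≢to p) _ (Path.first∈A (link p)) x∈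
        ; stop-in     = λ p → Path.last∈B (link p)
        ; stop-out    = λ p x∈ → beads-disjoint _ _ (from≢to p) _ x∈ (Path.last∈B (link p))
        ; inner-bead  = λ p j x → link-inner-∉bead p j
        ; inner-disj  = λ p q p≢q x → link-inners-disjoint p q p≢q
        }

      depth-≥ : ∀ i → i ≤ depth (stage i)
      depth-≥ zero    = z≤n
      depth-≥ (suc i) = Extension.m≤depth (extension i)

      necklace-meetsLateBeads : NecklaceFacts.MeetsLateBeads necklace R
      necklace-meetsLateBeads K m =
        K ⊔ m , depth (stage (K ⊔ m)) , m≤m⊔n K m , ≤-trans (m≤n⊔m K m) (depth-≥ (K ⊔ m)) , R∈Y (stage (K ⊔ m))

      beads-P : ∀ i → ∃ λ y → y ∈ bead necklace i × P y
      beads-P i = P∈Y (stage i)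

    limit⇔necklace : (v : V D) (R : Ray D) → Solid D R → (P : V D → Set) →
      (∀ X → ¬ InC D X R v → ∃ λ w → InC D X R w × P w) ⇔
      (∃ λ (N : Necklace D) → Represents D N R × (∀ i → ∃ λ y → y ∈ bead N i × P y))
    limit⇔necklace v R R-solid P = mk⇔ to-necklace from-necklace
      where
        to-necklace : (∀ X → ¬ InC D X R v → ∃ λ w → InC D X R w × P w) →
          ∃ λ (N : Necklace D) → Represents D N R × (∀ i → ∃ λ y → y ∈ bead N i × P y)
        to-necklace limit =
          necklace , NecklaceFacts.meetsLateBeads⇒represents necklace R R-solid necklace-meetsLateBeads , beads-P
          where
            open Construction R v P (λ X v∈X → limit X (λ v∈C → inC-∉ R v∈C v∈X))
        from-necklace : (∃ λ (N : Necklace D) → Represents D N R × (∀ i → ∃ λ y → y ∈ bead N i × P y)) →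
          ∀ X → ¬ InC D X R v → ∃ λ w → InC D X R w × P w
        from-necklace (N , N-rep , beads-P) X _ = NecklaceFacts.limit-from-necklace N R N-rep P beads-P X

proposition5p2 : ExcludedMiddle 0ℓ →
    (D : Digraph) (v : V D) (R : Ray D) → Solid D R →
    (LimitOut D v R ⇔ (∃ λ (N : Necklace D) → Represents D N R ×
        (∀ i → ∃ λ y → y ∈ bead N i × E D v y)))
    × (LimitIn D v R ⇔ (∃ λ (N : Necklace D) → Represents D N R ×
        (∀ i → ∃ λ y → y ∈ bead N i × E D y v)))
proposition5p2 lem D v R R-solid =
  limit⇔necklace D lem v R R-solid (E D v) , limit⇔necklace D lem v R R-solid (λ y → E D y v)
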